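{- For every positive integer $n$, the topdrop map $T:S_n\to S_n$ is a bijection.
   Context: Permutations $\pi\in S_n$ are written in one-line notation $\pi=\pi_1\pi_2\cdots\pi_n$. The topdrop map $T:S_n\to S_n$ is defined by $T(\pi_1\pi_2\cdots\pi_n)=\pi_{\pi_1+1}\pi_{\pi_1+2}\cdots\pi_n\,\pi_{\pi_1}\pi_{\pi_1-1}\cdots\pi_1$, i.e. the first $\pi_1$ entries are removed, reversed, and appended at the end (if $\pi_1=n$ the result is the reversal of $\pi$). -}

module Defs where

open import Data.Nat using (ℕ; suc)
open import Data.List using (List; []; _∷_; drop; take; reverse; _++_; map; upTo)
open import Data.List.Relation.Binary.Permutation.Propositional using (_↭_)
open import Relation.Binary.PropositionalEquality using (_≡_)
open import Data.Product using (_×_; ∃)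

IsPerm : ℕ → List ℕ → Set
IsPerm n w = w ↭ map suc (upTo n)

topdrop : List ℕ → List ℕ
topdrop []       = []
topdrop (x ∷ xs) = drop x (x ∷ xs) ++ reverse (take x (x ∷ xs))

TopdropBijective : ℕ → Set
TopdropBijective n =
  (∀ w → IsPerm n w → IsPerm n (topdrop w)) ×
  (∀ u v → IsPerm n u → IsPerm n v → topdrop u ≡ topdrop v → u ≡ v) ×
  (∀ v → IsPerm n v → ∃ λ u → IsPerm n u × topdrop u ≡ v)

-- Write π = B ++ A with B the first π₁ entries. Then topdrop π = A ++ reverse B is the reversal
-- of flipTail π = B ++ reverse A. On Sₙ the head π₁ satisfies 1 ≤ π₁ ≤ n, so flipTail keeps the
-- block B in place and is an involution; hence topdrop = reverse ∘ flipTail is a bijection of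
-- Sₙ with inverse flipTail ∘ reverse.
module Submission where

open import Defs
open import Data.Nat using (ℕ; zero; suc; _≤_; z≤n; s≤s)
open import Data.List using (List; []; _∷_; drop; take; reverse; _++_; map; upTo; length)
open import Data.List.Properties
  using (take++drop≡id; reverse-++; reverse-involutive; length-map; length-upTo)
open import Data.List.Relation.Binary.Permutation.Propositional
  using (_↭_; ↭-refl; ↭-trans; ↭-reflexive)
open import Data.List.Relation.Binary.Permutation.Propositional.Properties
  using (↭-length; ↭-reverse; ∈-resp-↭; ++⁺ˡ)
open import Data.List.Membership.Propositional using (_∈_)
open import Data.List.Membership.Propositional.Properties using (∈-map⁻; ∈-upTo⁻)
open import Data.List.Relation.Unary.Any using (here)
open import Data.Product using (_×_; _,_; ∃)
open import Relation.Binary.PropositionalEquality using (_≡_; refl; sym; trans; cong; subst; module ≡-Reasoning)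

module _ {a} {A : Set a} where

  reverseAfter : ℕ → List A → List A
  reverseAfter k xs = take k xs ++ reverse (drop k xs)

  reverseAfter-involutive : ∀ k (xs : List A) → k ≤ length xs →
                            reverseAfter k (reverseAfter k xs) ≡ xs
  reverseAfter-involutive zero    xs       _         = reverse-involutive xs
  reverseAfter-involutive (suc k) (x ∷ xs) (s≤s k≤n) = cong (x ∷_) (reverseAfter-involutive k xs k≤n)

  reverse-reverseAfter : ∀ k (xs : List A) →
                         reverse (reverseAfter k xs) ≡ drop k xs ++ reverse (take k xs)
  reverse-reverseAfter k xs = begin
    reverse (take k xs ++ reverse (drop k xs))
      ≡⟨ reverse-++ (take k xs) (reverse (drop k xs)) ⟩
    reverse (reverse (drop k xs)) ++ reverse (take k xs)
      ≡⟨ cong (_++ reverse (take k xs)) (reverse-involutive (drop k xs)) ⟩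
    drop k xs ++ reverse (take k xs) ∎
    where open ≡-Reasoning

  reverseAfter-↭ : ∀ k (xs : List A) → reverseAfter k xs ↭ xs
  reverseAfter-↭ k xs =
    ↭-trans (++⁺ˡ (take k xs) (↭-reverse (drop k xs))) (↭-reflexive (take++drop≡id k xs))

flipTail : List ℕ → List ℕ
flipTail []       = []
flipTail (x ∷ xs) = reverseAfter x (x ∷ xs)

flipTail-↭ : ∀ w → flipTail w ↭ w
flipTail-↭ []       = ↭-refl
flipTail-↭ (x ∷ xs) = reverseAfter-↭ x (x ∷ xs)

flipTail-involutive : ∀ {x} xs → 1 ≤ x → x ≤ length (x ∷ xs) → flipTail (flipTail (x ∷ xs)) ≡ x ∷ xs
flipTail-involutive xs (s≤s z≤n) (s≤s k≤n) = cong (_ ∷_) (reverseAfter-involutive _ xs k≤n)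

topdrop≡reverse∘flipTail : ∀ w → topdrop w ≡ reverse (flipTail w)
topdrop≡reverse∘flipTail []       = refl
topdrop≡reverse∘flipTail (x ∷ xs) = sym (reverse-reverseAfter x (x ∷ xs))

length-IsPerm : ∀ {n w} → IsPerm n w → length w ≡ n
length-IsPerm {n} p = trans (↭-length p) (trans (length-map suc (upTo n)) (length-upTo n))

∈-IsPerm : ∀ {n w x} → IsPerm n w → x ∈ w → 1 ≤ x × x ≤ n
∈-IsPerm p x∈w with ∈-map⁻ suc (∈-resp-↭ p x∈w)
... | _ , y∈upTo , refl = s≤s z≤n , ∈-upTo⁻ y∈upTo

flipTail-involutive-IsPerm : ∀ {n w} → IsPerm n w → flipTail (flipTail w) ≡ w
flipTail-involutive-IsPerm {w = []}     _ = refl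
flipTail-involutive-IsPerm {w = x ∷ xs} p with ∈-IsPerm p (here refl)
... | 1≤x , x≤n = flipTail-involutive xs 1≤x (subst (x ≤_) (sym (length-IsPerm p)) x≤n)

topdrop⁻¹ : List ℕ → List ℕ
topdrop⁻¹ w = flipTail (reverse w)

topdrop-↭ : ∀ w → topdrop w ↭ w
topdrop-↭ w = ↭-trans (↭-reflexive (topdrop≡reverse∘flipTail w))
                      (↭-trans (↭-reverse (flipTail w)) (flipTail-↭ w))

topdrop⁻¹-↭ : ∀ w → topdrop⁻¹ w ↭ w
topdrop⁻¹-↭ w = ↭-trans (flipTail-↭ (reverse w)) (↭-reverse w)

topdrop⁻¹-topdrop : ∀ {n u} → IsPerm n u → topdrop⁻¹ (topdrop u) ≡ u
topdrop⁻¹-topdrop {u = u} p = begin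
  flipTail (reverse (topdrop u))             ≡⟨ cong topdrop⁻¹ (topdrop≡reverse∘flipTail u) ⟩
  flipTail (reverse (reverse (flipTail u)))  ≡⟨ cong flipTail (reverse-involutive (flipTail u)) ⟩
  flipTail (flipTail u)                      ≡⟨ flipTail-involutive-IsPerm p ⟩
  u                                          ∎
  where open ≡-Reasoning

topdrop-topdrop⁻¹ : ∀ {n v} → IsPerm n v → topdrop (topdrop⁻¹ v) ≡ v
topdrop-topdrop⁻¹ {v = v} p = begin
  topdrop (flipTail (reverse v))             ≡⟨ topdrop≡reverse∘flipTail (flipTail (reverse v)) ⟩
  reverse (flipTail (flipTail (reverse v)))  ≡⟨ cong reverse (flipTail-involutive-IsPerm (↭-trans (↭-reverse v) p)) ⟩
  reverse (reverse v)                        ≡⟨ reverse-involutive v ⟩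
  v                                          ∎
  where open ≡-Reasoning

proposition2p3 : (n : ℕ) → 1 ≤ n → TopdropBijective n
proposition2p3 n _ = preserves , injective , surjective
  where
    preserves : ∀ w → IsPerm n w → IsPerm n (topdrop w)
    preserves w p = ↭-trans (topdrop-↭ w) p

    injective : ∀ u v → IsPerm n u → IsPerm n v → topdrop u ≡ topdrop v → u ≡ v
    injective u v pu pv eq =
      trans (sym (topdrop⁻¹-topdrop pu)) (trans (cong topdrop⁻¹ eq) (topdrop⁻¹-topdrop pv))

    surjective : ∀ v → IsPerm n v → ∃ λ u → IsPerm n u × topdrop u ≡ v
    surjective v p = topdrop⁻¹ v , ↭-trans (topdrop⁻¹-↭ v) p , topdrop-topdrop⁻¹ p
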